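{- Let $\pi\in\mathfrak{S}_n$ be indecomposable, $G=G_\pi$, and $s\in[n]$ a sink. For every spanning tree $T$ of $G$, the number $\mathrm{ext}(T)$ of edges of $G$ that are externally active for the order $\prec_T$ equals $\mathrm{level}(\phi_{TC}(T))$, where $\phi_{TC}(T)=c(T)$ is the configuration with $c_i(T)=\lambda_i(T)+\mu_i(T)+\nu_i(T)$.
   Context: $G_\pi$: vertex set $[n]$, with $a<b$ adjacent iff $b$ appears before $a$ in $\pi$; indecomposable means no $k<n$ with $\{\pi_1,\ldots,\pi_k\}=[k]$. Root $T$ at $s$; $h(i)$ is the distance to $s$ in $T$, $p(i)$ the parent of $i\neq s$, $T^{(k)}=\{i:h(i)=k\}$, $N_G(i)$ the neighbourhood in $G$. $\lambda_i(T)=|N_G(i)\cap T^{(>h(i))}|$, $\mu_i(T)=|N_G(i)\cap T^{(h(i))}|$, $\nu_i(T)=|\{j\in N_G(i)\cap T^{(h(i)-1)}:j<p(i)\}|$ for $i\ne s$, $\nu_s(T)=0$. $\mathrm{level}(c)=\sum_ic_i-|E(G)|$. The order $\prec_T$ on $E(G)$: visit the vertices of $T$ height by height ($0,1,2,\ldots$), and within a given height in decreasing order of labels. When visiting $v$, let $S$ be the set of edges $\{v,w\}$ of $G$ with $w$ not yet visited; append the edges of $S$ after all previously ordered edges, ordered among themselves by $\{v,w\}\prec_T\{v,w'\}$ iff $w>w'$. Stop once all edges are ordered. An edge $e\notin T$ is externally active for a total order $\prec$ if it is the $\prec$-maximal edge of the unique cycle in $T\cup\{e\}$; $\mathrm{ext}(T)$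 is the number of such edges. -}

module Defs where

open import Data.Nat as ℕ using (ℕ; zero; suc; _+_; _<ᵇ_; _≡ᵇ_)
open import Data.Integer as ℤ using (ℤ; +_; _-_)
open import Data.Fin as Fin using (Fin; toℕ)
open import Data.Fin.Permutation using (Permutation′; _⟨$⟩ʳ_; _⟨$⟩ˡ_)
open import Data.Bool using (Bool; true; false; _∧_; _∨_; if_then_else_)
open import Data.List using (List; []; _∷_; length; map; allFin)
open import Data.Nat.ListAction using (sum)
open import Data.List.Relation.Unary.Unique.Propositional using (Unique)
open import Data.List.Membership.Propositional using (_∈_)
open import Data.Product using (Σ; _×_; _,_)
open import Data.Sum using (_⊎_)
open import Relation.Nullary using (¬_; yes; no)
open import Relation.Binary.PropositionalEquality using (_≡_; _≢_)
open import Function.Bundles using (_⇔_)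

-- The vertex set [n] = {1,…,n} is represented by Fin n
-- (label i+1 ↦ i, so the order of labels is preserved).  Positions
-- 1..n of the word π = π_1 … π_n are likewise Fin n: the letter at
-- position k is  π ⟨$⟩ʳ k, the position of the letter b is  π ⟨$⟩ˡ b.

count : ∀ {n} → (Fin n → Bool) → ℕ
count {n} P = sum (map (λ j → if P j then 1 else 0) (allFin n))

_<F_ : ∀ {n} → Fin n → Fin n → Bool
a <F b = toℕ a <ᵇ toℕ b

Indecomposable : ∀ {n} → Permutation′ n → Set
Indecomposable {n} π =
  (k : ℕ) → 1 ℕ.≤ k → k ℕ.< n →
  ¬ ((x : Fin n) → (Σ (Fin n) λ j → toℕ j ℕ.< k × π ⟨$⟩ʳ j ≡ x) ⇔ toℕ x ℕ.< k)

adjᵇ : ∀ {n} → Permutation′ n → Fin n → Fin n → Bool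
adjᵇ π a b = (a <F b ∧ ((π ⟨$⟩ˡ b) <F (π ⟨$⟩ˡ a)))
           ∨ (b <F a ∧ ((π ⟨$⟩ˡ a) <F (π ⟨$⟩ˡ b)))

Adj : ∀ {n} → Permutation′ n → Fin n → Fin n → Set
Adj π a b = adjᵇ π a b ≡ true

numEdges : ∀ {n} → Permutation′ n → ℕ
numEdges {n} π = sum (map (λ a → count (λ b → a <F b ∧ adjᵇ π a b)) (allFin n))

module _ {n : ℕ} (R : Fin n → Fin n → Set) where

  data Walk : Fin n → Fin n → Set where
    [] : ∀ {u} → Walk u u
    _∷_ : ∀ {u w v} → R u w → Walk w v → Walk u v

  walkLength : ∀ {u v} → Walk u v → ℕ
  walkLength [] = 0
  walkLength (_ ∷ w) = suc (walkLength w)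

  tailVerts : ∀ {u v} → Walk u v → List (Fin n)
  tailVerts [] = []
  tailVerts (_∷_ {w = w} _ ws) = w ∷ tailVerts ws

  steps : ∀ {u v} → Walk u v → List (Fin n × Fin n)
  steps [] = []
  steps (_∷_ {u = u} {w = w} _ ws) = (u , w) ∷ steps ws

  IsCycle : ∀ {u} → Walk u u → Set
  IsCycle c = 3 ℕ.≤ walkLength c × Unique (tailVerts c)

  Connected : Set
  Connected = (u v : Fin n) → Walk u v

  Acyclic : Set
  Acyclic = ∀ {u} (c : Walk u u) → ¬ IsCycle c

  IsDist : Fin n → Fin n → ℕ → Set
  IsDist u v k = (Σ (Walk u v) λ w → walkLength w ≡ k)
               × ((w : Walk u v) → k ℕ.≤ walkLength w)

IsSpanningTree : ∀ {n} → (G T : Fin n → Fin n → Set) → Set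
IsSpanningTree {n} G T =
  ((a b : Fin n) → T a b → T b a) ×
  ((a b : Fin n) → T a b → G a b) ×
  Connected T × Acyclic T

-- For T rooted at s we take as input the height
-- function h (h i = distance from s to i in T) and the parent function
-- p (for i ≠ s, p i is the neighbour of i in T that is closer to s);
-- both are uniquely determined by T and s, via the specs below.

IsHeight : ∀ {n} → (T : Fin n → Fin n → Set) → Fin n → (Fin n → ℕ) → Set
IsHeight T s h = ∀ i → IsDist T s i (h i)

IsParentFn : ∀ {n} → (T : Fin n → Fin n → Set) → Fin n → (Fin n → ℕ)
           → (Fin n → Fin n) → Set
IsParentFn T s h p = ∀ i → i ≢ s → T i (p i) × suc (h (p i)) ≡ h i

module _ {n : ℕ} (π : Permutation′ n) (s : Fin n)
         (h : Fin n → ℕ) (p : Fin n → Fin n) where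

  λ-stat : Fin n → ℕ
  λ-stat i = count λ j → adjᵇ π i j ∧ (h i <ᵇ h j)

  μ-stat : Fin n → ℕ
  μ-stat i = count λ j → adjᵇ π i j ∧ (h i ≡ᵇ h j)

  ν-stat : Fin n → ℕ
  ν-stat i with i Fin.≟ s
  ... | yes _ = 0
  ... | no  _ = count λ j → adjᵇ π i j ∧ (suc (h j) ≡ᵇ h i) ∧ (j <F p i)

  config : Fin n → ℕ
  config i = λ-stat i + μ-stat i + ν-stat i

  level : ℤ
  level = + sum (map config (allFin n)) - + numEdges π

-- Vertices are visited height by height,
-- and within a height by decreasing label:  x is visited before y iff
-- h x < h y, or h x = h y and y < x.  An edge {x,y} is appended to the
-- order when its earlier-visited endpoint v is visited; among the edges
-- appended at v, {v,w} comes before {v,w'} iff w > w'.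

module _ {n : ℕ} (h : Fin n → ℕ) where

  visitedBeforeᵇ : Fin n → Fin n → Bool
  visitedBeforeᵇ x y = (h x <ᵇ h y) ∨ ((h x ≡ᵇ h y) ∧ (y <F x))

  firstEnd : Fin n × Fin n → Fin n
  firstEnd (x , y) = if visitedBeforeᵇ x y then x else y

  otherEnd : Fin n × Fin n → Fin n
  otherEnd (x , y) = if visitedBeforeᵇ x y then y else x

  _≺_ : Fin n × Fin n → Fin n × Fin n → Set
  e ≺ e' = (visitedBeforeᵇ (firstEnd e) (firstEnd e') ≡ true)
         ⊎ (firstEnd e ≡ firstEnd e' × toℕ (otherEnd e') ℕ.< toℕ (otherEnd e))

SameEdge : ∀ {n} → Fin n × Fin n → Fin n × Fin n → Set
SameEdge (x , y) (a , b) = (x ≡ a × y ≡ b) ⊎ (x ≡ b × y ≡ a)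

AddEdge : ∀ {n} → (Fin n → Fin n → Set) → Fin n × Fin n → Fin n → Fin n → Set
AddEdge T e x y = T x y ⊎ SameEdge (x , y) e

ExtActive : ∀ {n} → Permutation′ n → (T : Fin n → Fin n → Set)
          → (Fin n → ℕ) → Fin n × Fin n → Set
ExtActive {n} π T h (a , b) =
  toℕ a ℕ.< toℕ b × Adj π a b × ¬ T a b ×
  (∀ {u} (c : Walk (AddEdge T (a , b)) u u) → IsCycle (AddEdge T (a , b)) c →
     ∀ f → f ∈ steps (AddEdge T (a , b)) c → SameEdge f (a , b) ⊎ _≺_ h f (a , b))

HasSize : ∀ {n} → (Fin n × Fin n → Set) → ℕ → Set
HasSize {n} P k = Σ (List (Fin n × Fin n)) λ L →
  Unique L × ((e : Fin n × Fin n) → e ∈ L ⇔ P e) × length L ≡ k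

module Submission where

-- Every edge of T joins a vertex to its parent, so the cycle of T ∪ {a,b}
-- runs from a and b up to their nearest common ancestor, and all its other
-- vertices are strictly closer to the root than the deeper of a and b.
-- Comparing the first-visited endpoints of its edges shows that {a,b}, a < b,
-- is externally active exactly when h a = h b, or a and b lie on consecutive
-- levels and the upper one has a smaller label than the parent of the lower
-- one.  In Σ c_i every edge of G is counted by λ or μ at one end, and a second
-- time (by μ or ν) exactly when it is active; hence Σ c_i = |E(G)| + ext(T).

open import Defs
open import Data.Nat as ℕ using (ℕ; zero; suc; _+_; _≤_; _<_; z≤n; s≤s; _<ᵇ_; _≡ᵇ_)
open import Data.Nat.Properties
open import Algebra.Properties.CommutativeSemigroup +-commutativeSemigroup using (interchange)
open import Data.Nat.ListAction using (sum)
open import Data.Nat.ListAction.Properties using (sum-++)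
open import Data.Integer as ℤ using (+_; _-_)
import Data.Integer.Properties as ℤ
open import Data.Fin as Fin using (Fin; toℕ)
open import Data.Fin.Properties using (toℕ-injective)
open import Data.Fin.Permutation using (Permutation′)
open import Data.Bool using (Bool; true; false; T; T?; _∧_; _∨_; if_then_else_)
open import Data.Bool.Properties using (T-≡; T-∧; T-∨; ∨-comm; ∧-zeroʳ)
open import Data.List using (List; []; _∷_; _++_; [_]; map; length; allFin; cartesianProduct; filterᵇ)
open import Data.List.Properties using (map-++; map-∘)
open import Data.List.Membership.Propositional using (_∈_)
open import Data.List.Membership.Propositional.Properties
  using (∈-++⁻; ∈-filter⁺; ∈-filter⁻; ∈-allFin; ∈-cartesianProduct⁺)
open import Data.List.Relation.Unary.Any using (here; there)
open import Data.List.Relation.Unary.All as All using ([])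
open import Data.List.Relation.Unary.AllPairs using ([]; _∷_)
open import Data.List.Relation.Unary.Unique.Propositional using (Unique)
import Data.List.Relation.Unary.Unique.Propositional.Properties as Unique
open import Data.Product using (Σ; ∃; _×_; _,_; proj₁; proj₂; uncurry)
open import Data.Sum using (_⊎_; inj₁; inj₂; [_,_]′)
open import Data.Empty using (⊥-elim)
open import Function using (_∘_; case_of_)
open import Function.Bundles using (_⇔_; mk⇔; Equivalence)
open import Function.Properties.Equivalence using () renaming (trans to ⇔-trans; sym to ⇔-sym)
open import Relation.Nullary using (¬_; yes; no; contradiction)
open import Relation.Unary using (Decidable)
open import Relation.Binary using (tri<; tri≈; tri>)
open import Relation.Binary.PropositionalEquality hiding ([_])

module _ {n : ℕ} {R : Fin n → Fin n → Set} where

  infixr 5 _++ʷ_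

  _++ʷ_ : ∀ {u v w} → Walk R u v → Walk R v w → Walk R u w
  []      ++ʷ w′ = w′
  (e ∷ w) ++ʷ w′ = e ∷ (w ++ʷ w′)

  walkLength-++ʷ : ∀ {u v w} (w₁ : Walk R u v) (w₂ : Walk R v w) →
                   walkLength R (w₁ ++ʷ w₂) ≡ walkLength R w₁ + walkLength R w₂
  walkLength-++ʷ []       w₂ = refl
  walkLength-++ʷ (e ∷ w₁) w₂ = cong suc (walkLength-++ʷ w₁ w₂)

  tailVerts-++ʷ : ∀ {u v w} (w₁ : Walk R u v) (w₂ : Walk R v w) →
                  tailVerts R (w₁ ++ʷ w₂) ≡ tailVerts R w₁ ++ tailVerts R w₂
  tailVerts-++ʷ []       w₂ = refl
  tailVerts-++ʷ (e ∷ w₁) w₂ = cong (_ ∷_) (tailVerts-++ʷ w₁ w₂)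

  -- Concatenation along an equation between the meeting endpoints, which
  -- in applications are not syntactically equal.
  _++⟨_⟩_ : ∀ {u v v′ w} → Walk R u v → v ≡ v′ → Walk R v′ w → Walk R u w
  w₁ ++⟨ meet ⟩ w₂ = w₁ ++ʷ subst (λ z → Walk R z _) (sym meet) w₂

  closedWalk-isCycle : ∀ {x y z z′} (e : R x y) (w₁ : Walk R y z) (meet : z ≡ z′) (w₂ : Walk R z′ x) →
    2 ≤ walkLength R w₁ + walkLength R w₂ → Unique (y ∷ tailVerts R w₁ ++ tailVerts R w₂) →
    IsCycle R (e ∷ (w₁ ++⟨ meet ⟩ w₂))
  closedWalk-isCycle e w₁ refl w₂ 2≤length unique =
    subst (3 ≤_) (cong suc (sym (walkLength-++ʷ w₁ w₂))) (s≤s 2≤length) ,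
    subst (Unique ∘ (_ ∷_)) (sym (tailVerts-++ʷ w₁ w₂)) unique

  walkLength≡0⇒endpoints≡ : ∀ {u v} (w : Walk R u v) → walkLength R w ≡ 0 → u ≡ v
  walkLength≡0⇒endpoints≡ [] _ = refl

module _ {n : ℕ} {R R′ : Fin n → Fin n → Set} (f : ∀ {a b} → R a b → R′ a b) where

  mapʷ : ∀ {u v} → Walk R u v → Walk R′ u v
  mapʷ []      = []
  mapʷ (e ∷ w) = f e ∷ mapʷ w

  walkLength-mapʷ : ∀ {u v} (w : Walk R u v) → walkLength R′ (mapʷ w) ≡ walkLength R w
  walkLength-mapʷ []      = refl
  walkLength-mapʷ (e ∷ w) = cong suc (walkLength-mapʷ w)

  tailVerts-mapʷ : ∀ {u v} (w : Walk R u v) → tailVerts R′ (mapʷ w) ≡ tailVerts R w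
  tailVerts-mapʷ []      = refl
  tailVerts-mapʷ (e ∷ w) = cong (_ ∷_) (tailVerts-mapʷ w)

Neighbours : ∀ {n} → (Fin n → Fin n → Set) → Fin n → Fin n → Set
Neighbours R x y = R x y ⊎ R y x

module _ {n : ℕ} {R : Fin n → Fin n → Set} where

  -- Positions beyond the end return the last vertex.
  vertexAt : ∀ {u v} → Walk R u v → ℕ → Fin n
  vertexAt {u} w       zero    = u
  vertexAt {u} []      (suc i) = u
  vertexAt     (e ∷ w) (suc i) = vertexAt w i

  vertexAt-walkLength : ∀ {u v} (w : Walk R u v) → vertexAt w (walkLength R w) ≡ v
  vertexAt-walkLength []      = refl
  vertexAt-walkLength (e ∷ w) = vertexAt-walkLength w

  vertexAt-step : ∀ {u v} (w : Walk R u v) i → i < walkLength R w →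
                  R (vertexAt w i) (vertexAt w (suc i))
  vertexAt-step (e ∷ [])      zero    _         = e
  vertexAt-step (e ∷ (_ ∷ _)) zero    _         = e
  vertexAt-step (e ∷ w)       (suc i) (s≤s i<l) = vertexAt-step w i i<l

  ∈-steps⇒vertexAt : ∀ {u v} (w : Walk R u v) {f} → f ∈ steps R w →
                     ∃ λ i → i < walkLength R w × f ≡ (vertexAt w i , vertexAt w (suc i))
  ∈-steps⇒vertexAt (e ∷ [])      (here refl) = 0 , s≤s z≤n , refl
  ∈-steps⇒vertexAt (e ∷ (_ ∷ _)) (here refl) = 0 , s≤s z≤n , refl
  ∈-steps⇒vertexAt (e ∷ w)       (there f∈) with ∈-steps⇒vertexAt w f∈
  ... | i , i<l , refl = suc i , s≤s i<l , refl

  vertexAt∈tailVerts : ∀ {u v} (w : Walk R u v) i → 1 ≤ i → i ≤ walkLength R w →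
                       vertexAt w i ∈ tailVerts R w
  vertexAt∈tailVerts (e ∷ [])      1             _ _         = here refl
  vertexAt∈tailVerts (e ∷ (_ ∷ _)) 1             _ _         = here refl
  vertexAt∈tailVerts (e ∷ w)       (suc (suc i)) _ (s≤s i≤l) =
    there (vertexAt∈tailVerts w (suc i) (s≤s z≤n) i≤l)

  vertexAt-injective : ∀ {u v} (w : Walk R u v) → Unique (tailVerts R w) →
                       ∀ {i j} → 1 ≤ i → i < j → j ≤ walkLength R w → vertexAt w i ≢ vertexAt w j
  vertexAt-injective (e ∷ w) (fresh ∷ _) {1} {suc j} _ (s≤s j≥1) (s≤s j≤l) eq =
    All.lookup fresh (vertexAt∈tailVerts w j j≥1 j≤l) eq
  vertexAt-injective (e ∷ w) (_ ∷ unique) {suc (suc i)} {suc j} _ (s≤s i<j) (s≤s j≤l) =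
    vertexAt-injective w unique (s≤s z≤n) i<j j≤l

  -- The two neighbours are found at positions 1 … walkLength, where the
  -- vertices of a cycle are distinct; position 0 repeats the last one.
  cycle-neighbours : ∀ {u} (c : Walk R u u) → IsCycle R c → ∀ m → m ≤ walkLength R c →
    ∃ λ i → ∃ λ j → 1 ≤ i × i < j × j ≤ walkLength R c ×
      Neighbours R (vertexAt c m) (vertexAt c i) × Neighbours R (vertexAt c m) (vertexAt c j)
  cycle-neighbours {u} c (3≤l , _) = neighbours
    where
    l = walkLength R c
    Goal : Fin n → Set
    Goal z = ∃ λ i → ∃ λ j → 1 ≤ i × i < j × j ≤ l ×
      Neighbours R z (vertexAt c i) × Neighbours R z (vertexAt c j)
    last≡first : vertexAt c l ≡ u
    last≡first = vertexAt-walkLength c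
    step : ∀ i → i < l → R (vertexAt c i) (vertexAt c (suc i))
    step = vertexAt-step c
    l′ = ℕ.pred l
    suc-l′ : suc l′ ≡ l
    suc-l′ = suc-pred l {{ℕ.>-nonZero (≤-trans (s≤s z≤n) 3≤l)}}
    neighbours : ∀ m → m ≤ l → Goal (vertexAt c m)
    neighbours 1 _ =
      2 , l , s≤s z≤n , 3≤l , ≤-refl ,
      inj₁ (step 1 (≤-trans (s≤s (s≤s z≤n)) 3≤l)) ,
      inj₂ (subst (λ z → R z (vertexAt c 1)) (sym last≡first) (step 0 (≤-trans (s≤s z≤n) 3≤l)))
    neighbours (suc (suc k)) m≤l with m≤n⇒m<n∨m≡n m≤l
    ... | inj₁ m<l =
      suc k , suc (suc (suc k)) , s≤s z≤n , s≤s (s≤s (n≤1+n k)) , m<l ,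
      inj₂ (step (suc k) (≤-trans (n≤1+n _) m<l)) , inj₁ (step (suc (suc k)) m<l)
    ... | inj₂ m≡l = subst Goal (sym (trans (cong (vertexAt c) m≡l) last≡first)) (neighbours zero z≤n)
    neighbours zero _ =
      1 , l′ , ≤-refl , ≤-pred (subst (3 ≤_) (sym suc-l′) 3≤l) , subst (l′ ≤_) suc-l′ (n≤1+n l′) ,
      inj₁ (step 0 (≤-trans (s≤s z≤n) 3≤l)) ,
      inj₂ (subst (R (vertexAt c l′)) (trans (cong (vertexAt c) suc-l′) last≡first)
                  (step l′ (subst (l′ <_) suc-l′ ≤-refl)))

module _ {P : ℕ → Set} (P? : Decidable P) where

  least : ∀ v → (∃ λ k → k ≤ v × P k) → ∃ λ k → k ≤ v × P k × (∀ i → i < k → ¬ P i)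
  least zero    (0 , z≤n , p0) = 0 , z≤n , p0 , λ _ ()
  least (suc v) (k , k≤v , pk) with anyUpTo? P? k
  ... | no none = k , k≤v , pk , λ i i<k pi → none (i , i<k , pi)
  ... | yes (i , i<k , pi) with least v (i , ≤-pred (≤-trans i<k k≤v) , pi)
  ...   | j , j≤v , pj , minimal = j , m≤n⇒m≤1+n j≤v , pj , minimal

argmax : (g : ℕ → ℕ) (l : ℕ) → ∃ λ m → m ≤ l × (∀ i → i ≤ l → g i ≤ g m)
argmax g zero = 0 , z≤n , λ { 0 z≤n → ≤-refl }
argmax g (suc l) with argmax g l
... | m , m≤l , maximal with g m ≤? g (suc l)
...   | yes gm≤ = suc l , ≤-refl , λ i i≤ → case m≤n⇒m<n∨m≡n i≤ of λ
          { (inj₁ i<) → ≤-trans (maximal i (≤-pred i<)) gm≤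
          ; (inj₂ refl) → ≤-refl }
...   | no gm≰ = m , m≤n⇒m≤1+n m≤l , λ i i≤ → case m≤n⇒m<n∨m≡n i≤ of λ
          { (inj₁ i<) → maximal i (≤-pred i<)
          ; (inj₂ refl) → <⇒≤ (≰⇒> gm≰) }

module RootedTree {n : ℕ} {T : Fin n → Fin n → Set} (T-sym : ∀ {a b} → T a b → T b a)
                  {s : Fin n} {h : Fin n → ℕ} (h-dist : IsHeight T s h)
                  {p : Fin n → Fin n} (p-parent : IsParentFn T s h p) where

  height-root : h s ≡ 0
  height-root = n≤0⇒n≡0 (proj₂ (h-dist s) [])

  height≡0⇒root : ∀ {x} → h x ≡ 0 → x ≡ s
  height≡0⇒root {x} hx≡0 with proj₁ (h-dist x)
  ... | w , length≡ = sym (walkLength≡0⇒endpoints≡ w (trans length≡ hx≡0))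

  height>0⇒nonroot : ∀ {x} → 0 < h x → x ≢ s
  height>0⇒nonroot 0<hx refl = <⇒≢ 0<hx (sym height-root)

  height-parent : ∀ {x} → x ≢ s → suc (h (p x)) ≡ h x
  height-parent {x} x≢s = proj₂ (p-parent x x≢s)

  edge-parent : ∀ {x} → x ≢ s → T x (p x)
  edge-parent {x} x≢s = proj₁ (p-parent x x≢s)

  height-edge : ∀ {x y} → T x y → h y ≤ suc (h x)
  height-edge {x} {y} e with proj₁ (h-dist x)
  ... | w , length≡ = subst (h y ≤_) length-extended (proj₂ (h-dist y) (w ++ʷ (e ∷ [])))
    where
    length-extended : walkLength T (w ++ʷ (e ∷ [])) ≡ suc (h x)
    length-extended = trans (walkLength-++ʷ w (e ∷ [])) (trans (+-comm _ 1) (cong suc length≡))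

  ancestor : ℕ → Fin n → Fin n
  ancestor zero    x = x
  ancestor (suc k) x = ancestor k (p x)

  suc≤height⇒nonroot : ∀ {k x} → suc k ≤ h x → x ≢ s
  suc≤height⇒nonroot k<hx = height>0⇒nonroot (≤-trans (s≤s z≤n) k<hx)

  suc≤height⇒≤height-parent : ∀ {k x} → suc k ≤ h x → k ≤ h (p x)
  suc≤height⇒≤height-parent k<hx =
    ≤-pred (subst (_ ≤_) (sym (height-parent (suc≤height⇒nonroot k<hx))) k<hx)

  height-ancestor : ∀ k x → k ≤ h x → h (ancestor k x) + k ≡ h x
  height-ancestor zero    x _    = +-identityʳ _
  height-ancestor (suc k) x k<hx = begin
    h (ancestor k (p x)) + suc k ≡⟨ +-suc _ k ⟩
    suc (h (ancestor k (p x)) + k) ≡⟨ cong suc (height-ancestor k (p x) (suc≤height⇒≤height-parent k<hx)) ⟩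
    suc (h (p x))                  ≡⟨ height-parent (suc≤height⇒nonroot k<hx) ⟩
    h x                            ∎
    where open ≡-Reasoning

  ancestor-height≡root : ∀ x → ancestor (h x) x ≡ s
  ancestor-height≡root x = height≡0⇒root (+-cancelʳ-≡ (h x) _ 0 (height-ancestor (h x) x ≤-refl))

  height-ancestor-< : ∀ {i x} → 1 ≤ i → i ≤ h x → h (ancestor i x) < h x
  height-ancestor-< {i} {x} 1≤i i≤hx = subst (h (ancestor i x) <_) (height-ancestor i x i≤hx) (m<m+n _ 1≤i)

  ancestor-injective : ∀ {i j x} → i ≤ h x → j ≤ h x → ancestor i x ≡ ancestor j x → i ≡ j
  ancestor-injective {i} {j} {x} i≤hx j≤hx same = +-cancelˡ-≡ (h (ancestor i x)) i j (begin
    h (ancestor i x) + i ≡⟨ height-ancestor i x i≤hx ⟩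
    h x                  ≡⟨ height-ancestor j x j≤hx ⟨
    h (ancestor j x) + j ≡⟨ cong (λ z → h z + j) same ⟨
    h (ancestor i x) + j ∎)
    where open ≡-Reasoning

  ancestor-at-height⇒self : ∀ {j x} → j ≤ h x → h x ≤ h (ancestor j x) → ancestor j x ≡ x
  ancestor-at-height⇒self {j} {x} j≤hx hx≤ =
    cong (λ i → ancestor i x) (n≤0⇒n≡0 (+-cancelˡ-≤ (h (ancestor j x)) j 0 (begin
    h (ancestor j x) + j ≡⟨ height-ancestor j x j≤hx ⟩
    h x                  ≤⟨ hx≤ ⟩
    h (ancestor j x)     ≡⟨ +-identityʳ _ ⟨
    h (ancestor j x) + 0 ∎)))
    where open ≤-Reasoning

  pathUp : ∀ k x → k ≤ h x → Walk T x (ancestor k x)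
  pathUp zero    x _    = []
  pathUp (suc k) x k<hx =
    edge-parent (suc≤height⇒nonroot k<hx) ∷ pathUp k (p x) (suc≤height⇒≤height-parent k<hx)

  walkLength-pathUp : ∀ k x k≤hx → walkLength T (pathUp k x k≤hx) ≡ k
  walkLength-pathUp zero    x _ = refl
  walkLength-pathUp (suc k) x _ = cong suc (walkLength-pathUp k _ _)

  ∈-pathUp : ∀ k x k≤hx {z} → z ∈ tailVerts T (pathUp k x k≤hx) →
             ∃ λ i → 1 ≤ i × i ≤ k × z ≡ ancestor i x
  ∈-pathUp (suc zero)    x _ (here refl) = 1 , ≤-refl , ≤-refl , refl
  ∈-pathUp (suc (suc k)) x _ (here refl) = 1 , ≤-refl , s≤s z≤n , refl
  ∈-pathUp (suc k)       x _ (there z∈) with ∈-pathUp k (p x) _ z∈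
  ... | i , _ , i≤k , refl = suc i , s≤s z≤n , s≤s i≤k , refl

  pathUp-unique : ∀ k x k≤hx → Unique (tailVerts T (pathUp k x k≤hx))
  pathUp-unique zero    x _    = []
  pathUp-unique (suc k) x k<hx = All.tabulate parent-fresh ∷ pathUp-unique k (p x) _
    where
    k≤hpx = suc≤height⇒≤height-parent k<hx
    parent-fresh : ∀ {z} → z ∈ tailVerts T (pathUp k (p x) k≤hpx) → p x ≢ z
    parent-fresh z∈ refl with ∈-pathUp k (p x) k≤hpx z∈
    ... | i , 1≤i , i≤k , eq = <⇒≢ (height-ancestor-< 1≤i (≤-trans i≤k k≤hpx)) (cong h (sym eq))

  pathDown : ∀ k x → k ≤ h x → Walk T (ancestor k x) x
  pathDown zero    x _    = []
  pathDown (suc k) x k<hx =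
    pathDown k (p x) (suc≤height⇒≤height-parent k<hx) ++ʷ (T-sym (edge-parent (suc≤height⇒nonroot k<hx)) ∷ [])

  walkLength-pathDown : ∀ k x k≤hx → walkLength T (pathDown k x k≤hx) ≡ k
  walkLength-pathDown zero    x _ = refl
  walkLength-pathDown (suc k) x _ =
    trans (walkLength-++ʷ (pathDown k (p x) _) _) (trans (+-comm _ 1) (cong suc (walkLength-pathDown k _ _)))

  ∈-pathDown : ∀ k x k≤hx {z} → z ∈ tailVerts T (pathDown k x k≤hx) → ∃ λ i → i < k × z ≡ ancestor i x
  ∈-pathDown (suc k) x k<hx z∈
    with ∈-++⁻ (tailVerts T (pathDown k (p x) _)) (subst (_ ∈_) (tailVerts-++ʷ (pathDown k (p x) _) _) z∈)
  ... | inj₁ z∈′ with ∈-pathDown k (p x) _ z∈′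
  ...   | i , i<k , eq = suc i , s≤s i<k , eq
  ∈-pathDown (suc k) x k<hx z∈ | inj₂ (here refl) = 0 , s≤s z≤n , refl

  pathDown-unique : ∀ k x k≤hx → Unique (tailVerts T (pathDown k x k≤hx))
  pathDown-unique zero    x _    = []
  pathDown-unique (suc k) x k<hx =
    subst Unique (sym (tailVerts-++ʷ (pathDown k (p x) k≤hpx) _))
          (Unique.++⁺ (pathDown-unique k (p x) k≤hpx) ([] ∷ []) x-fresh)
    where
    k≤hpx = suc≤height⇒≤height-parent k<hx
    x-fresh : ∀ {v} → ¬ (v ∈ tailVerts T (pathDown k (p x) k≤hpx) × v ∈ [ x ])
    x-fresh (v∈ , here refl) with ∈-pathDown k (p x) k≤hpx v∈
    ... | i , i<k , eq =
      <⇒≢ (height-ancestor-< (s≤s z≤n) (≤-trans i<k (≤-trans (n≤1+n k) k<hx))) (cong h (sym eq))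

  AncestorOf : Fin n → Fin n → Set
  AncestorOf x z = ∃ λ j → j < suc (h x) × z ≡ ancestor j x

  nearestCommonAncestor : ∀ x y →
    ∃ λ k → k ≤ h y × AncestorOf x (ancestor k y) × (∀ i → i < k → ¬ AncestorOf x (ancestor i y))
  nearestCommonAncestor x y =
    least (λ k → anyUpTo? (λ j → ancestor k y Fin.≟ ancestor j x) (suc (h x))) (h y)
          (h y , ≤-refl , h x , ≤-refl , trans (ancestor-height≡root y) (sym (ancestor-height≡root x)))

  pathUp-pathDown-unique : ∀ {x y k j} (k<hy : suc k ≤ h y) (j≤hx : j ≤ h x) →
    ancestor (suc k) y ≡ ancestor j x → (∀ i → i < suc k → ¬ AncestorOf x (ancestor i y)) →
    Unique (y ∷ tailVerts T (pathUp (suc k) y k<hy) ++ tailVerts T (pathDown j x j≤hx))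
  pathUp-pathDown-unique {x} {y} {k} {j} k<hy j≤hx meet nearest =
    All.tabulate (λ z∈ → [ y∉U , y∉D ]′ (∈-++⁻ U z∈)) ∷
    Unique.++⁺ (pathUp-unique (suc k) y k<hy) (pathDown-unique j x j≤hx) U∩D-empty
    where
    U = tailVerts T (pathUp (suc k) y k<hy)
    D = tailVerts T (pathDown j x j≤hx)

    y∉U : ∀ {z} → z ∈ U → y ≢ z
    y∉U z∈ refl with ∈-pathUp (suc k) y k<hy z∈
    ... | i , 1≤i , i≤k , eq = <⇒≢ (height-ancestor-< 1≤i (≤-trans i≤k k<hy)) (cong h (sym eq))

    y∉D : ∀ {z} → z ∈ D → y ≢ z
    y∉D z∈ refl with ∈-pathDown j x j≤hx z∈
    ... | i , i<j , eq = nearest 0 (s≤s z≤n) (i , <-trans i<j (s≤s j≤hx) , eq)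

    U∩D-empty : ∀ {v} → ¬ (v ∈ U × v ∈ D)
    U∩D-empty (v∈U , v∈D) with ∈-pathUp (suc k) y k<hy v∈U | ∈-pathDown j x j≤hx v∈D
    ... | i , _ , i≤k , v≡up | i′ , i′<j , v≡down with m≤n⇒m<n∨m≡n i≤k
    ...   | inj₁ i<k  = nearest i i<k (i′ , <-trans i′<j (s≤s j≤hx) , trans (sym v≡up) v≡down)
    ...   | inj₂ refl = <⇒≢ i′<j (ancestor-injective (≤-trans (<⇒≤ i′<j) j≤hx) j≤hx
                                   (trans (sym v≡down) (trans v≡up meet)))

  module _ {R : Fin n → Fin n → Set} (T⊆R : ∀ {a b} → T a b → R a b) where

    -- The fundamental cycle of x – y through the nearest common ancestor.
    cycle-through-parentEdge : ∀ {x y} → R x y → x ≢ y → h x ≤ h y → p y ≢ x →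
      ∃ λ (c : Walk R x x) → IsCycle R c × (y , p y) ∈ steps R c
    cycle-through-parentEdge {x} {y} xy x≢y hx≤hy py≢x with nearestCommonAncestor x y
    ... | zero , _ , (j , j< , y≡) , _ =
      contradiction (sym (trans y≡ (ancestor-at-height⇒self (≤-pred j<) (subst (h x ≤_) (cong h y≡) hx≤hy))))
                    x≢y
    ... | suc k , k<hy , (j , j< , meet) , nearest =
      xy ∷ (up ++⟨ meet ⟩ down) , closedWalk-isCycle xy up meet down 2≤length unique , there (here refl)
      where
      up   = mapʷ T⊆R (pathUp (suc k) y k<hy)
      down = mapʷ T⊆R (pathDown j x (≤-pred j<))

      2≤length : 2 ≤ walkLength R up + walkLength R down
      2≤length = subst (2 ≤_) (sym (cong₂ _+_
        (trans (walkLength-mapʷ T⊆R (pathUp (suc k) y k<hy)) (walkLength-pathUp (suc k) y k<hy))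
        (trans (walkLength-mapʷ T⊆R (pathDown j x (≤-pred j<))) (walkLength-pathDown j x (≤-pred j<)))))
        (at-least-two k j meet)
        where
        at-least-two : ∀ k j → ancestor (suc k) y ≡ ancestor j x → 2 ≤ suc k + j
        at-least-two zero    zero    py≡x = contradiction py≡x py≢x
        at-least-two zero    (suc j) _    = s≤s (s≤s z≤n)
        at-least-two (suc k) j       _    = s≤s (s≤s z≤n)

      unique : Unique (y ∷ tailVerts R up ++ tailVerts R down)
      unique = subst (λ vs → Unique (y ∷ vs)) (sym (cong₂ _++_
        (tailVerts-mapʷ T⊆R (pathUp (suc k) y k<hy)) (tailVerts-mapʷ T⊆R (pathDown j x (≤-pred j<)))))
        (pathUp-pathDown-unique k<hy (≤-pred j<) meet nearest)

  module _ (acyclic : Acyclic T) (T-irrefl : ∀ {x} → ¬ T x x) where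

    private
      edge⇒≢ : ∀ {x y} → T x y → x ≢ y
      edge⇒≢ e refl = T-irrefl e

      sameHeight⇒not-parent : ∀ {x y} → x ≢ y → h x ≡ h y → p y ≢ x
      sameHeight⇒not-parent {x} {y} x≢y hx≡hy py≡x with h y ℕ.≟ 0
      ... | yes hy≡0 = x≢y (trans (height≡0⇒root (trans hx≡hy hy≡0)) (sym (height≡0⇒root hy≡0)))
      ... | no  hy≢0 = 1+n≢n (begin
        suc (h x)     ≡⟨ cong (suc ∘ h) py≡x ⟨
        suc (h (p y)) ≡⟨ height-parent (λ y≡s → hy≢0 (trans (cong h y≡s) height-root)) ⟩
        h y           ≡⟨ hx≡hy ⟨
        h x           ∎)
        where open ≡-Reasoning

      edge⇒heights≢ : ∀ {x y} → T x y → h x ≢ h y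
      edge⇒heights≢ {x} {y} e hx≡hy
        with cycle-through-parentEdge (λ t → t) e (edge⇒≢ e) (≤-reflexive hx≡hy)
                                      (sameHeight⇒not-parent (edge⇒≢ e) hx≡hy)
      ... | c , c-cycle , _ = acyclic c c-cycle

      edge-down⇒parent : ∀ {x y} → T x y → suc (h y) ≡ h x → y ≡ p x
      edge-down⇒parent {x} {y} e hy<hx with y Fin.≟ p x
      ... | yes y≡px = y≡px
      ... | no  y≢px with cycle-through-parentEdge (λ t → t) (T-sym e) (edge⇒≢ (T-sym e))
                                                   (≤-trans (n≤1+n _) (≤-reflexive hy<hx)) (y≢px ∘ sym)
      ...   | c , c-cycle , _ = contradiction c-cycle (acyclic c)

    edge⇒parent⊎child : ∀ {x y} → T x y → (suc (h y) ≡ h x × y ≡ p x) ⊎ (suc (h x) ≡ h y × x ≡ p y)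
    edge⇒parent⊎child {x} {y} e with <-cmp (h x) (h y)
    ... | tri< hx<hy _ _ = let hy≡ = ≤-antisym (height-edge e) hx<hy
                           in inj₂ (sym hy≡ , edge-down⇒parent (T-sym e) (sym hy≡))
    ... | tri≈ _ hx≡hy _ = contradiction hx≡hy (edge⇒heights≢ e)
    ... | tri> _ _ hy<hx = let hx≡ = ≤-antisym (height-edge (T-sym e)) hy<hx
                           in inj₁ (sym hx≡ , edge-down⇒parent e (sym hx≡))

module VisitOrder {n : ℕ} (h : Fin n → ℕ) where

  VisitedBefore : Fin n → Fin n → Set
  VisitedBefore x y = h x < h y ⊎ (h x ≡ h y × toℕ y < toℕ x)

  visitedBeforeᵇ⇔ : ∀ {x y} → visitedBeforeᵇ h x y ≡ true ⇔ VisitedBefore x y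
  visitedBeforeᵇ⇔ {x} {y} = mk⇔ to from
    where
    to : visitedBeforeᵇ h x y ≡ true → VisitedBefore x y
    to vb with Equivalence.to T-∨ (Equivalence.from T-≡ vb)
    ... | inj₁ hx<hy = inj₁ (<ᵇ⇒< _ _ hx<hy)
    ... | inj₂ level-and-label with Equivalence.to T-∧ level-and-label
    ...   | hx≡hy , y<x = inj₂ (≡ᵇ⇒≡ _ _ hx≡hy , <ᵇ⇒< _ _ y<x)
    from : VisitedBefore x y → visitedBeforeᵇ h x y ≡ true
    from (inj₁ hx<hy) = Equivalence.to T-≡ (Equivalence.from T-∨ (inj₁ (<⇒<ᵇ hx<hy)))
    from (inj₂ (hx≡hy , y<x)) =
      Equivalence.to T-≡ (Equivalence.from T-∨ (inj₂ (Equivalence.from T-∧ (≡⇒≡ᵇ _ _ hx≡hy , <⇒<ᵇ y<x))))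

  visitedBefore-asym : ∀ {x y} → VisitedBefore x y → ¬ VisitedBefore y x
  visitedBefore-asym (inj₁ hx<hy)       (inj₁ hy<hx)       = <-asym hx<hy hy<hx
  visitedBefore-asym (inj₁ hx<hy)       (inj₂ (hy≡hx , _)) = <⇒≢ hx<hy (sym hy≡hx)
  visitedBefore-asym (inj₂ (hx≡hy , _)) (inj₁ hy<hx)       = <⇒≢ hy<hx (sym hx≡hy)
  visitedBefore-asym (inj₂ (_ , y<x))   (inj₂ (_ , x<y))   = <-asym y<x x<y

  firstEnd-visitedBefore : ∀ {x y} → VisitedBefore x y → firstEnd h (x , y) ≡ x
  firstEnd-visitedBefore {x} {y} x⊏y rewrite Equivalence.from visitedBeforeᵇ⇔ x⊏y = refl

  firstEnd-visitedAfter : ∀ {x y} → VisitedBefore y x → firstEnd h (x , y) ≡ y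
  firstEnd-visitedAfter {x} {y} y⊏x with visitedBeforeᵇ h x y in x⊏y
  ... | true  = contradiction y⊏x (visitedBefore-asym (Equivalence.to visitedBeforeᵇ⇔ x⊏y))
  ... | false = refl

  firstEnd-sameEdge : ∀ {x y a b} → SameEdge (x , y) (a , b) → h x < h y → firstEnd h (a , b) ≡ x
  firstEnd-sameEdge (inj₁ (refl , refl)) hx<hy = firstEnd-visitedBefore (inj₁ hx<hy)
  firstEnd-sameEdge (inj₂ (refl , refl)) hx<hy = firstEnd-visitedAfter (inj₁ hx<hy)

  ≺-byFirstEnd : ∀ {e e′} → VisitedBefore (firstEnd h e) (firstEnd h e′) → _≺_ h e e′
  ≺-byFirstEnd = inj₁ ∘ Equivalence.from visitedBeforeᵇ⇔

module Activity {n : ℕ} (h : Fin n → ℕ) (p : Fin n → Fin n) where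

  data Active (a b : Fin n) : Set where
    same-level     : h a ≡ h b → Active a b
    a-parent-level : suc (h a) ≡ h b → toℕ a < toℕ (p b) → Active a b
    b-parent-level : suc (h b) ≡ h a → toℕ b < toℕ (p a) → Active a b

  activeᵇ : Fin n → Fin n → Bool
  activeᵇ a b = (h a ≡ᵇ h b) ∨ ((suc (h a) ≡ᵇ h b) ∧ (a <F p b)) ∨ ((suc (h b) ≡ᵇ h a) ∧ (b <F p a))

  activeᵇ⇔ : ∀ {a b} → T (activeᵇ a b) ⇔ Active a b
  activeᵇ⇔ {a} {b} = mk⇔ to from
    where
    parent-level : ∀ {x y} → T ((suc (h x) ≡ᵇ h y) ∧ (x <F p y)) → suc (h x) ≡ h y × toℕ x < toℕ (p y)
    parent-level t = let (levels , labels) = Equivalence.to T-∧ t in ≡ᵇ⇒≡ _ _ levels , <ᵇ⇒< _ _ labels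
    parent-levelᵇ : ∀ {x y} → suc (h x) ≡ h y → toℕ x < toℕ (p y) → T ((suc (h x) ≡ᵇ h y) ∧ (x <F p y))
    parent-levelᵇ {x} {y} levels labels =
      Equivalence.from (T-∧ {suc (h x) ≡ᵇ h y}) (≡⇒≡ᵇ _ _ levels , <⇒<ᵇ labels)
    to : T (activeᵇ a b) → Active a b
    to t with Equivalence.to T-∨ t
    ... | inj₁ same = same-level (≡ᵇ⇒≡ _ _ same)
    ... | inj₂ t′ with Equivalence.to T-∨ t′
    ...   | inj₁ below = uncurry a-parent-level (parent-level below)
    ...   | inj₂ above = uncurry b-parent-level (parent-level above)
    from : Active a b → T (activeᵇ a b)
    from (same-level ha≡hb) = Equivalence.from T-∨ (inj₁ (≡⇒≡ᵇ _ _ ha≡hb))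
    from (a-parent-level levels labels) = Equivalence.from (T-∨ {h a ≡ᵇ h b})
      (inj₂ (Equivalence.from (T-∨ {(suc (h a) ≡ᵇ h b) ∧ (a <F p b)}) (inj₁ (parent-levelᵇ levels labels))))
    from (b-parent-level levels labels) = Equivalence.from (T-∨ {h a ≡ᵇ h b})
      (inj₂ (Equivalence.from (T-∨ {(suc (h a) ≡ᵇ h b) ∧ (a <F p b)}) (inj₂ (parent-levelᵇ levels labels))))

module ExternalActivity {n : ℕ} {T : Fin n → Fin n → Set} (T-sym : ∀ {a b} → T a b → T b a)
                        {s : Fin n} {h : Fin n → ℕ} (h-dist : IsHeight T s h)
                        {p : Fin n → Fin n} (p-parent : IsParentFn T s h p)
                        (acyclic : Acyclic T) (T-irrefl : ∀ {x} → ¬ T x x) where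

  open RootedTree T-sym h-dist p-parent
  open VisitOrder h
  open Activity h p

  ≺-MaximalInCycles : Fin n → Fin n → Set
  ≺-MaximalInCycles a b =
    ∀ {u} (c : Walk (AddEdge T (a , b)) u u) → IsCycle (AddEdge T (a , b)) c →
      ∀ f → f ∈ steps (AddEdge T (a , b)) c → SameEdge f (a , b) ⊎ _≺_ h f (a , b)

  private
    parent⊎child : ∀ {x y} → T x y → (suc (h y) ≡ h x × y ≡ p x) ⊎ (suc (h x) ≡ h y × x ≡ p y)
    parent⊎child = edge⇒parent⊎child acyclic T-irrefl

  active⇒non-tree : ∀ {a b} → Active a b → ¬ T a b
  active⇒non-tree act e with parent⊎child e | act
  ... | inj₁ (hb+1≡ha , _) | same-level ha≡hb         = 1+n≢n (trans hb+1≡ha ha≡hb)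
  ... | inj₂ (ha+1≡hb , _) | same-level ha≡hb         = 1+n≢n (trans ha+1≡hb (sym ha≡hb))
  ... | inj₁ (hb+1≡ha , _) | a-parent-level ha+1≡hb _ = <-asym (≤-reflexive hb+1≡ha) (≤-reflexive ha+1≡hb)
  ... | inj₂ (_ , a≡pb)    | a-parent-level _ a<pb    = <⇒≢ a<pb (cong toℕ a≡pb)
  ... | inj₁ (_ , b≡pa)    | b-parent-level _ b<pa    = <⇒≢ b<pa (cong toℕ b≡pa)
  ... | inj₂ (ha+1≡hb , _) | b-parent-level hb+1≡ha _ = <-asym (≤-reflexive hb+1≡ha) (≤-reflexive ha+1≡hb)

  parent-visitedBefore⇒parent-level : ∀ {x y} → y ≢ s → h x < h y → VisitedBefore (p y) x →
                                      suc (h x) ≡ h y × toℕ x < toℕ (p y)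
  parent-visitedBefore⇒parent-level y≢s hx<hy (inj₁ hpy<hx) =
    contradiction (subst (h _ <_) (sym (height-parent y≢s)) hx<hy) (<⇒≱ hpy<hx ∘ ≤-pred)
  parent-visitedBefore⇒parent-level y≢s hx<hy (inj₂ (hpy≡hx , x<py)) =
    trans (cong suc (sym hpy≡hx)) (height-parent y≢s) , x<py

  module _ (a b : Fin n) where

    private
      R : Fin n → Fin n → Set
      R = AddEdge T (a , b)

    OnOrBelow : Fin n → Set
    OnOrBelow v = v ≡ a ⊎ v ≡ b ⊎ h v < h a ℕ.⊔ h b

    sameEdge-tree : ∀ {x y} → SameEdge (x , y) (a , b) → T x y → T a b
    sameEdge-tree (inj₁ (x≡a , y≡b)) xy = subst₂ T x≡a y≡b xy
    sameEdge-tree (inj₂ (x≡b , y≡a)) xy = T-sym (subst₂ T x≡b y≡a xy)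

    sameEdge-shared-endpoint : ∀ {x y z} → SameEdge (x , y) (a , b) → SameEdge (y , z) (a , b) → z ≡ x ⊎ y ≡ x
    sameEdge-shared-endpoint (inj₁ (x≡a , _)) (inj₁ (y≡a , _)) = inj₂ (trans y≡a (sym x≡a))
    sameEdge-shared-endpoint (inj₁ (x≡a , _)) (inj₂ (_ , z≡a)) = inj₁ (trans z≡a (sym x≡a))
    sameEdge-shared-endpoint (inj₂ (x≡b , _)) (inj₁ (_ , z≡b)) = inj₁ (trans z≡b (sym x≡b))
    sameEdge-shared-endpoint (inj₂ (x≡b , _)) (inj₂ (y≡b , _)) = inj₂ (trans y≡b (sym x≡b))

    lower-neighbour⇒parent : ∀ {v w} → v ≢ a → v ≢ b → h w ≤ h v → Neighbours R v w → w ≡ p v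
    lower-neighbour⇒parent {v} {w} v≢a v≢b hw≤hv vw with parent⊎child (tree-edge vw)
      where
      tree-edge : Neighbours R v w → T v w
      tree-edge (inj₁ (inj₁ e))                 = e
      tree-edge (inj₁ (inj₂ (inj₁ (v≡a , _)))) = contradiction v≡a v≢a
      tree-edge (inj₁ (inj₂ (inj₂ (v≡b , _)))) = contradiction v≡b v≢b
      tree-edge (inj₂ (inj₁ e))                 = T-sym e
      tree-edge (inj₂ (inj₂ (inj₁ (_ , v≡b)))) = contradiction v≡b v≢b
      tree-edge (inj₂ (inj₂ (inj₂ (_ , v≡a)))) = contradiction v≡a v≢a
    ... | inj₁ (_ , w≡pv)  = w≡pv
    ... | inj₂ (hv<hw , _) = contradiction (≤-trans (≤-reflexive hv<hw) hw≤hv) (<-irrefl refl)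

    module _ {u} (c : Walk R u u) (c-cycle : IsCycle R c) where

      private
        l = walkLength R c
        height-at : ℕ → ℕ
        height-at i = h (vertexAt c i)

      -- Off the edge {a,b}, both cycle-neighbours of a highest vertex would be its parent.
      highest⇒on-edge : ∀ m → m ≤ l → (∀ i → i ≤ l → height-at i ≤ height-at m) →
                        vertexAt c m ≡ a ⊎ vertexAt c m ≡ b
      highest⇒on-edge m m≤l highest with vertexAt c m Fin.≟ a | vertexAt c m Fin.≟ b
      ... | yes z≡a | _       = inj₁ z≡a
      ... | no  _   | yes z≡b = inj₂ z≡b
      ... | no  z≢a | no  z≢b with cycle-neighbours c c-cycle m m≤l
      ...   | i , j , 1≤i , i<j , j≤l , zi , zj = ⊥-elim (
        vertexAt-injective c (proj₂ c-cycle) 1≤i i<j j≤l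
          (trans (lower-neighbour⇒parent z≢a z≢b (highest i (≤-trans (<⇒≤ i<j) j≤l)) zi)
            (sym (lower-neighbour⇒parent z≢a z≢b (highest j j≤l) zj))))

      cycle⇒onOrBelow : ∀ i → i ≤ l → OnOrBelow (vertexAt c i)
      cycle⇒onOrBelow i i≤l with argmax height-at l
      ... | m , m≤l , highest with m≤n⇒m<n∨m≡n (highest i i≤l)
      ...   | inj₁ lower = inj₂ (inj₂ (<-≤-trans lower (on-edge⇒≤⊔ (highest⇒on-edge m m≤l highest))))
        where
        on-edge⇒≤⊔ : ∀ {z} → z ≡ a ⊎ z ≡ b → h z ≤ h a ℕ.⊔ h b
        on-edge⇒≤⊔ (inj₁ refl) = m≤m⊔n (h a) (h b)
        on-edge⇒≤⊔ (inj₂ refl) = m≤n⊔m (h a) (h b)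
      ...   | inj₂ as-high
        with highest⇒on-edge i i≤l (λ j j≤l → subst (height-at j ≤_) (sym as-high) (highest j j≤l))
      ...     | inj₁ z≡a = inj₁ z≡a
      ...     | inj₂ z≡b = inj₂ (inj₁ z≡b)

    -- On a cycle through {a,b} every other edge is a tree edge v – p v, and
    -- p v, its first-visited endpoint, comes before the first endpoint of {a,b}.
    parent-before-firstEnd : toℕ a < toℕ b → Active a b →
      ∀ {v} → v ≢ s → OnOrBelow v → VisitedBefore (p v) (firstEnd h (a , b))
    parent-before-firstEnd a<b (same-level ha≡hb) {v} v≢s v-low
      rewrite firstEnd-visitedAfter (inj₂ (sym ha≡hb , a<b)) =
        inj₁ (<-≤-trans (≤-reflexive (height-parent v≢s)) (hv≤hb v-low))
      where
      hv≤hb : OnOrBelow v → h v ≤ h b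
      hv≤hb (inj₁ refl)        = ≤-reflexive ha≡hb
      hv≤hb (inj₂ (inj₁ refl)) = ≤-refl
      hv≤hb (inj₂ (inj₂ hv<))  = <⇒≤ (subst (h v <_) (m≤n⇒m⊔n≡n (≤-reflexive ha≡hb)) hv<)
    parent-before-firstEnd a<b (a-parent-level ha+1≡hb a<pb) {v} v≢s v-low
      rewrite firstEnd-visitedBefore (inj₁ (≤-reflexive ha+1≡hb)) = before-a v-low
      where
      before-a : OnOrBelow v → VisitedBefore (p v) a
      before-a (inj₁ refl)        = inj₁ (≤-reflexive (height-parent v≢s))
      before-a (inj₂ (inj₁ refl)) = inj₂ (suc-injective (trans (height-parent v≢s) (sym ha+1≡hb)) , a<pb)
      before-a (inj₂ (inj₂ hv<))  = inj₁ (<-≤-trans (≤-reflexive (height-parent v≢s))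
        (≤-pred (subst (h v <_) (trans (m≤n⇒m⊔n≡n (<⇒≤ (≤-reflexive ha+1≡hb))) (sym ha+1≡hb)) hv<)))
    parent-before-firstEnd a<b (b-parent-level hb+1≡ha b<pa) {v} v≢s v-low
      rewrite firstEnd-visitedAfter (inj₁ (≤-reflexive hb+1≡ha)) = before-b v-low
      where
      before-b : OnOrBelow v → VisitedBefore (p v) b
      before-b (inj₁ refl)        = inj₂ (suc-injective (trans (height-parent v≢s) (sym hb+1≡ha)) , b<pa)
      before-b (inj₂ (inj₁ refl)) = inj₁ (≤-reflexive (height-parent v≢s))
      before-b (inj₂ (inj₂ hv<))  = inj₁ (<-≤-trans (≤-reflexive (height-parent v≢s))
        (≤-pred (subst (h v <_) (trans (m≥n⇒m⊔n≡m (<⇒≤ (≤-reflexive hb+1≡ha))) (sym hb+1≡ha)) hv<)))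

    parentEdge-≺ : toℕ a < toℕ b → Active a b →
      ∀ {e v} → v ≢ s → firstEnd h e ≡ p v → OnOrBelow v → _≺_ h e (a , b)
    parentEdge-≺ a<b act v≢s first≡pv v-low =
      ≺-byFirstEnd (subst (λ z → VisitedBefore z _) (sym first≡pv) (parent-before-firstEnd a<b act v≢s v-low))

    active⇒≺-maximalInCycles : toℕ a < toℕ b → Active a b → ≺-MaximalInCycles a b
    active⇒≺-maximalInCycles a<b act c c-cycle f f∈ with ∈-steps⇒vertexAt c f∈
    ... | i , i<l , refl with vertexAt-step c i i<l
    ...   | inj₂ same = inj₁ same
    ...   | inj₁ e with parent⊎child e
    ...     | inj₁ (hv≡ , w≡pv) = inj₂ (parentEdge-≺ a<b act (suc≤height⇒nonroot (≤-reflexive hv≡))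
      (trans (firstEnd-visitedAfter (inj₁ (≤-reflexive hv≡))) w≡pv) (cycle⇒onOrBelow c c-cycle i (<⇒≤ i<l)))
    ...     | inj₂ (hv≡ , v≡pw) = inj₂ (parentEdge-≺ a<b act (suc≤height⇒nonroot (≤-reflexive hv≡))
      (trans (firstEnd-visitedBefore (inj₁ (≤-reflexive hv≡))) v≡pw) (cycle⇒onOrBelow c c-cycle (suc i) i<l))

    -- If {a,b} is ≺-maximal, the tree edge from the deeper endpoint y to its
    -- parent lies on a cycle with {a,b}, so that parent is visited before x.
    ≺-maximalInCycles⇒parent-level : ¬ T a b → ≺-MaximalInCycles a b →
      ∀ {x y} → SameEdge (x , y) (a , b) → h x < h y → suc (h x) ≡ h y × toℕ x < toℕ (p y)
    ≺-maximalInCycles⇒parent-level ¬ab maximal {x} {y} xy≈ab hx<hy =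
      conclude (maximal c c-cycle (y , p y) py∈)
      where
      y≢s : y ≢ s
      y≢s = height>0⇒nonroot (≤-trans (s≤s z≤n) hx<hy)
      x≢y : x ≢ y
      x≢y x≡y = <⇒≢ hx<hy (cong h x≡y)
      py≢x : p y ≢ x
      py≢x py≡x = ¬ab (sameEdge-tree xy≈ab (T-sym (subst (T y) py≡x (edge-parent y≢s))))

      fundamental = cycle-through-parentEdge inj₁ (inj₂ xy≈ab) x≢y (<⇒≤ hx<hy) py≢x
      c = proj₁ fundamental
      c-cycle = proj₁ (proj₂ fundamental)
      py∈ = proj₂ (proj₂ fundamental)

      firstEnd-py : firstEnd h (y , p y) ≡ p y
      firstEnd-py = firstEnd-visitedAfter (inj₁ (≤-reflexive (height-parent y≢s)))
      firstEnd-ab : firstEnd h (a , b) ≡ x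
      firstEnd-ab = firstEnd-sameEdge xy≈ab hx<hy

      conclude : SameEdge (y , p y) (a , b) ⊎ _≺_ h (y , p y) (a , b) → suc (h x) ≡ h y × toℕ x < toℕ (p y)
      conclude (inj₁ py≈ab) = contradiction (sameEdge-shared-endpoint xy≈ab py≈ab) [ py≢x , x≢y ∘ sym ]′
      conclude (inj₂ (inj₁ py⊏ab)) =
        parent-visitedBefore⇒parent-level y≢s hx<hy
          (subst₂ VisitedBefore firstEnd-py firstEnd-ab (Equivalence.to visitedBeforeᵇ⇔ py⊏ab))
      conclude (inj₂ (inj₂ (same-first , _))) =
        contradiction (trans (sym firstEnd-py) (trans same-first firstEnd-ab)) py≢x

    ≺-maximalInCycles⇒active : ¬ T a b → ≺-MaximalInCycles a b → Active a b
    ≺-maximalInCycles⇒active ¬ab maximal with <-cmp (h a) (h b)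
    ... | tri< ha<hb _ _ = uncurry a-parent-level (parent-level (inj₁ (refl , refl)) ha<hb)
      where parent-level = ≺-maximalInCycles⇒parent-level ¬ab maximal
    ... | tri≈ _ ha≡hb _ = same-level ha≡hb
    ... | tri> _ _ hb<ha = uncurry b-parent-level (parent-level (inj₂ (refl , refl)) hb<ha)
      where parent-level = ≺-maximalInCycles⇒parent-level ¬ab maximal

  extActive⇔ : ∀ {π a b} → ExtActive π T h (a , b) ⇔ (toℕ a < toℕ b × Adj π a b × Active a b)
  extActive⇔ {π} {a} {b} = mk⇔
    (λ (a<b , adj , ¬ab , maximal) → a<b , adj , ≺-maximalInCycles⇒active a b ¬ab maximal)
    (λ (a<b , adj , act) → a<b , adj , active⇒non-tree act , active⇒≺-maximalInCycles a b a<b act)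

indicator : Bool → ℕ
indicator b = if b then 1 else 0

module _ {A : Set} where

  sum-map-cong : ∀ (xs : List A) {f g : A → ℕ} → (∀ x → f x ≡ g x) → sum (map f xs) ≡ sum (map g xs)
  sum-map-cong []       _    = refl
  sum-map-cong (x ∷ xs) f≗g = cong₂ _+_ (f≗g x) (sum-map-cong xs f≗g)

  sum-map-+ : ∀ (xs : List A) f g → sum (map (λ x → f x + g x) xs) ≡ sum (map f xs) + sum (map g xs)
  sum-map-+ []       f g = refl
  sum-map-+ (x ∷ xs) f g rewrite sum-map-+ xs f g = interchange (f x) (g x) (sum (map f xs)) (sum (map g xs))

  sum-map-0 : ∀ (xs : List A) → sum (map (λ _ → 0) xs) ≡ 0
  sum-map-0 []       = refl
  sum-map-0 (_ ∷ xs) = sum-map-0 xs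

  length-filterᵇ : ∀ (P : A → Bool) xs → length (filterᵇ P xs) ≡ sum (map (indicator ∘ P) xs)
  length-filterᵇ P []       = refl
  length-filterᵇ P (x ∷ xs) with P x
  ... | true  = cong suc (length-filterᵇ P xs)
  ... | false = length-filterᵇ P xs

module _ {A B : Set} where

  sum-map-swap : ∀ (xs : List A) (ys : List B) (f : A → B → ℕ) →
    sum (map (λ x → sum (map (f x) ys)) xs) ≡ sum (map (λ y → sum (map (λ x → f x y) xs)) ys)
  sum-map-swap []       ys f = sym (sum-map-0 ys)
  sum-map-swap (x ∷ xs) ys f rewrite sum-map-swap xs ys f = sym (sum-map-+ ys (f x) _)

  sum-map-cartesianProduct : ∀ (xs : List A) (ys : List B) (g : A × B → ℕ) →
    sum (map g (cartesianProduct xs ys)) ≡ sum (map (λ x → sum (map (λ y → g (x , y)) ys)) xs)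
  sum-map-cartesianProduct []       ys g = refl
  sum-map-cartesianProduct (x ∷ xs) ys g = begin
    sum (map g (map (x ,_) ys ++ cartesianProduct xs ys))
      ≡⟨ cong sum (map-++ g (map (x ,_) ys) _) ⟩
    sum (map g (map (x ,_) ys) ++ map g (cartesianProduct xs ys))
      ≡⟨ sum-++ (map g (map (x ,_) ys)) _ ⟩
    sum (map g (map (x ,_) ys)) + sum (map g (cartesianProduct xs ys))
      ≡⟨ cong₂ _+_ (cong sum (sym (map-∘ ys))) (sum-map-cartesianProduct xs ys g) ⟩
    sum (map (λ y → g (x , y)) ys) + sum (map (λ x → sum (map (λ y → g (x , y)) ys)) xs) ∎
    where open ≡-Reasoning

+-diagonal-injective : ∀ {m k} → m + m ≡ k + k → m ≡ k
+-diagonal-injective {m} {k} eq with <-cmp m k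
... | tri< m<k _ _ = contradiction eq (<⇒≢ (+-mono-< m<k m<k))
... | tri≈ _ m≡k _ = m≡k
... | tri> _ _ k<m = contradiction (sym eq) (<⇒≢ (+-mono-< k<m k<m))

sum-map-symmetrise : ∀ {A : Set} (xs : List A) (F G : A → A → ℕ) →
  (∀ i j → F i j + F j i ≡ G i j + G j i) →
  sum (map (λ i → sum (map (F i) xs)) xs) ≡ sum (map (λ i → sum (map (G i) xs)) xs)
sum-map-symmetrise xs F G sym-eq = +-diagonal-injective (begin
  ∑∑ F + ∑∑ F                                 ≡⟨ cong (_+_ (∑∑ F)) (sum-map-swap xs xs F) ⟩
  ∑∑ F + sum (map (λ i → ∑ (λ j → F j i)) xs) ≡⟨ sum-map-+ xs _ _ ⟨
  sum (map (λ i → ∑ (F i) + ∑ (λ j → F j i)) xs)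
    ≡⟨ sum-map-cong xs (λ i → trans (sym (sum-map-+ xs (F i) _)) (trans
         (sum-map-cong xs (sym-eq i)) (sum-map-+ xs (G i) _))) ⟩
  sum (map (λ i → ∑ (G i) + ∑ (λ j → G j i)) xs) ≡⟨ sum-map-+ xs _ _ ⟩
  ∑∑ G + sum (map (λ i → ∑ (λ j → G j i)) xs) ≡⟨ cong (_+_ (∑∑ G)) (sum-map-swap xs xs G) ⟨
  ∑∑ G + ∑∑ G                                 ∎)
  where
  open ≡-Reasoning
  ∑ : (_ → ℕ) → ℕ
  ∑ f = sum (map f xs)
  ∑∑ : (_ → _ → ℕ) → ℕ
  ∑∑ H = sum (map (λ i → ∑ (H i)) xs)

-- For vertices i, j with A = adjᵇ π i j, x = h i, y = h j, O = (i <F j),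
-- P = (i <F p j) and Q = (j <F p i): levelContribution A x y Q is j's share of
-- c_i, activeLevels x y P Q is activeᵇ i j, and edgeCount counts {i,j} once in
-- |E(G)| and once more if it is an active edge with i < j.
levelContribution : Bool → ℕ → ℕ → Bool → ℕ
levelContribution A x y P =
  indicator (A ∧ (x <ᵇ y)) + indicator (A ∧ (x ≡ᵇ y)) + indicator (A ∧ (suc y ≡ᵇ x) ∧ P)

activeLevels : ℕ → ℕ → Bool → Bool → Bool
activeLevels x y P Q = (x ≡ᵇ y) ∨ ((suc x ≡ᵇ y) ∧ P) ∨ ((suc y ≡ᵇ x) ∧ Q)

edgeCount : Bool → Bool → Bool → ℕ
edgeCount O A active = indicator ((O ∧ A) ∧ active) + indicator (O ∧ A)

levelContribution-pair : ∀ x y P Q →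
  levelContribution true x y Q + levelContribution true y x P ≡ indicator (activeLevels x y P Q) + 1
levelContribution-pair zero    zero    P Q = refl
levelContribution-pair zero    (suc y) P Q with (zero ≡ᵇ y) ∧ P
... | true  = refl
... | false = refl
levelContribution-pair (suc x) zero    P Q with (zero ≡ᵇ x) ∧ Q
... | true  = refl
... | false = refl
levelContribution-pair (suc x) (suc y) P Q = levelContribution-pair x y P Q

levelContribution-symmetrised : ∀ A O O′ x y P Q →
  (A ≡ true → (O ≡ true × O′ ≡ false) ⊎ (O ≡ false × O′ ≡ true)) →
  levelContribution A x y Q + levelContribution A y x P ≡
  edgeCount O A (activeLevels x y P Q) + edgeCount O′ A (activeLevels y x Q P)
levelContribution-symmetrised false false false x y P Q _ = refl
levelContribution-symmetrised false false true  x y P Q _ = refl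
levelContribution-symmetrised false true  false x y P Q _ = refl
levelContribution-symmetrised false true  true  x y P Q _ = refl
levelContribution-symmetrised true  O     O′    x y P Q oriented with oriented refl
... | inj₁ (refl , refl) = trans (levelContribution-pair x y P Q) (sym (+-identityʳ _))
... | inj₂ (refl , refl) =
  trans (+-comm (levelContribution true x y Q) _) (levelContribution-pair y x Q P)

¬<⇒<ᵇ≡false : ∀ {m n} → ¬ m < n → (m <ᵇ n) ≡ false
¬<⇒<ᵇ≡false {m} {n} m≮n with m <ᵇ n in m<ᵇn
... | true  = contradiction (<ᵇ⇒< m n (Equivalence.from T-≡ m<ᵇn)) m≮n
... | false = refl

module _ {n : ℕ} (π : Permutation′ n) where

  adjᵇ-sym : ∀ a b → adjᵇ π a b ≡ adjᵇ π b a
  adjᵇ-sym a b = ∨-comm (a <F b ∧ _) (b <F a ∧ _)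

  adjᵇ-irrefl : ∀ a → adjᵇ π a a ≡ false
  adjᵇ-irrefl a rewrite ¬<⇒<ᵇ≡false (<-irrefl (refl {x = toℕ a})) = refl

module Counting {n : ℕ} (π : Permutation′ n) {s : Fin n} {h : Fin n → ℕ} (h-root : h s ≡ 0)
                (p : Fin n → Fin n) where

  open Activity h p

  extActiveᵇ : Fin n × Fin n → Bool
  extActiveᵇ (a , b) = (a <F b ∧ adjᵇ π a b) ∧ activeᵇ a b

  activeEdges : List (Fin n × Fin n)
  activeEdges = filterᵇ extActiveᵇ (cartesianProduct (allFin n) (allFin n))

  private
    all = allFin n

    contribution : Fin n → Fin n → ℕ
    contribution i j = levelContribution (adjᵇ π i j) (h i) (h j) (j <F p i)

    edgeContribution : Fin n → Fin n → ℕ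
    edgeContribution i j = edgeCount (i <F j) (adjᵇ π i j) (activeᵇ i j)

    config≡∑contribution : ∀ i → config π s h p i ≡ sum (map (contribution i) all)
    config≡∑contribution i = sym (trans (sum-map-+ all _ _) (cong₂ _+_ (sum-map-+ all _ _) (ν≡∑ i)))
      where
      ν≡∑ : ∀ i → sum (map (λ j → indicator (adjᵇ π i j ∧ (suc (h j) ≡ᵇ h i) ∧ (j <F p i))) all)
                ≡ ν-stat π s h p i
      ν≡∑ i with i Fin.≟ s
      ... | no  _    = refl
      ... | yes refl = trans (sum-map-cong all root-summand) (sum-map-0 all)
        where
        root-summand : ∀ j → indicator (adjᵇ π s j ∧ (suc (h j) ≡ᵇ h s) ∧ (j <F p s)) ≡ 0
        root-summand j rewrite h-root = cong indicator (∧-zeroʳ (adjᵇ π s j))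

    contribution-symmetrised : ∀ i j → contribution i j + contribution j i ≡ edgeContribution i j + edgeContribution j i
    contribution-symmetrised i j rewrite adjᵇ-sym π j i =
      levelContribution-symmetrised (adjᵇ π i j) (i <F j) (j <F i) (h i) (h j) (i <F p j) (j <F p i) oriented
      where
      oriented : adjᵇ π i j ≡ true →
                 ((i <F j) ≡ true × (j <F i) ≡ false) ⊎ ((i <F j) ≡ false × (j <F i) ≡ true)
      oriented adj with <-cmp (toℕ i) (toℕ j)
      ... | tri< i<j _ _ = inj₁ (Equivalence.to T-≡ (<⇒<ᵇ i<j) , ¬<⇒<ᵇ≡false (<⇒≯ i<j))
      ... | tri> _ _ j<i = inj₂ (¬<⇒<ᵇ≡false (<⇒≯ j<i) , Equivalence.to T-≡ (<⇒<ᵇ j<i))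
      ... | tri≈ _ i≡j _ with toℕ-injective i≡j
      ...   | refl = contradiction (trans (sym adj) (adjᵇ-irrefl π i)) λ ()

  ∑config≡activeEdges+numEdges : sum (map (config π s h p) all) ≡ length activeEdges + numEdges π
  ∑config≡activeEdges+numEdges = begin
    ∑ (config π s h p)                  ≡⟨ sum-map-cong all config≡∑contribution ⟩
    ∑ (λ i → ∑ (contribution i))        ≡⟨ sum-map-symmetrise all _ _ contribution-symmetrised ⟩
    ∑ (λ i → ∑ (edgeContribution i))    ≡⟨ sum-map-cong all (λ i → sum-map-+ all _ _) ⟩
    ∑ (λ i → ∑ (λ j → indicator (extActiveᵇ (i , j))) + count (λ j → i <F j ∧ adjᵇ π i j))
      ≡⟨ sum-map-+ all _ _ ⟩
    ∑ (λ i → ∑ (λ j → indicator (extActiveᵇ (i , j)))) + numEdges π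
      ≡⟨ cong (_+ numEdges π) (sum-map-cartesianProduct all all _) ⟨
    sum (map (indicator ∘ extActiveᵇ) (cartesianProduct all all)) + numEdges π
      ≡⟨ cong (_+ numEdges π) (length-filterᵇ extActiveᵇ (cartesianProduct all all)) ⟨
    length activeEdges + numEdges π     ∎
    where
    open ≡-Reasoning
    ∑ : (Fin n → ℕ) → ℕ
    ∑ f = sum (map f all)

  ∈-activeEdges⇔ : ∀ {a b} → (a , b) ∈ activeEdges ⇔ (toℕ a < toℕ b × Adj π a b × Active a b)
  ∈-activeEdges⇔ {a} {b} = mk⇔ to from
    where
    to : (a , b) ∈ activeEdges → toℕ a < toℕ b × Adj π a b × Active a b
    to e∈ with Equivalence.to T-∧ (proj₂ (∈-filter⁻ (T? ∘ extActiveᵇ) {xs = cartesianProduct all all} e∈))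
    ... | edge , active with Equivalence.to T-∧ edge
    ...   | a<b , adj = <ᵇ⇒< _ _ a<b , Equivalence.to T-≡ adj , Equivalence.to activeᵇ⇔ active
    from : toℕ a < toℕ b × Adj π a b × Active a b → (a , b) ∈ activeEdges
    from (a<b , adj , act) =
      ∈-filter⁺ (T? ∘ extActiveᵇ) (∈-cartesianProduct⁺ (∈-allFin a) (∈-allFin b))
        (Equivalence.from T-∧ (Equivalence.from T-∧ (<⇒<ᵇ a<b , Equivalence.from T-≡ adj) ,
                               Equivalence.from activeᵇ⇔ act))

  activeEdges-unique : Unique activeEdges
  activeEdges-unique =
    Unique.filter⁺ (T? ∘ extActiveᵇ) (Unique.cartesianProduct⁺ (Unique.allFin⁺ n) (Unique.allFin⁺ n))

+[m+n]-+n≡+m : ∀ m n → + (m + n) - + n ≡ + m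
+[m+n]-+n≡+m m n = trans (ℤ.m-n≡m⊖n (m + n) n) (trans (ℤ.⊖-≥ (m≤n+m n m)) (cong +_ (m+n∸n≡m m n)))

theorem3p8 : ∀ {n} (π : Permutation′ n) → Indecomposable π →
    (s : Fin n) (T : Fin n → Fin n → Set) → IsSpanningTree (Adj π) T →
    (h : Fin n → ℕ) → IsHeight T s h →
    (p : Fin n → Fin n) → IsParentFn T s h p →
    Σ ℕ λ ext → HasSize (ExtActive π T h) ext × + ext ≡ level π s h p
-- Indecomposability of π and connectedness of T only guarantee that T, h and p
-- exist; the count itself uses acyclicity and the rooted-tree data.
theorem3p8 {n} π _ s T (T-sym , T⊆G , _ , acyclic) h h-dist p p-parent =
  length activeEdges ,
  (activeEdges , activeEdges-unique , (λ (a , b) → ⇔-trans ∈-activeEdges⇔ (⇔-sym (extActive⇔ {π}))) , refl) ,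
  sym (trans (cong (λ t → + t - + numEdges π) ∑config≡activeEdges+numEdges)
             (+[m+n]-+n≡+m (length activeEdges) (numEdges π)))
  where
  T-irrefl : ∀ {x} → ¬ T x x
  T-irrefl {x} t = contradiction (trans (sym (T⊆G x x t)) (adjᵇ-irrefl π x)) λ ()
  open RootedTree (T-sym _ _) h-dist p-parent using (height-root)
  open Counting π {h = h} height-root p
  open ExternalActivity (T-sym _ _) h-dist p-parent acyclic T-irrefl using (extActive⇔)
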